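{- Let $p$ be a finite path in $G_n$, let $m\ge n$, and let $\tilde p$ be a path in $G_m$ with $\pi_{m,n}(\tilde p)=p$. If $x_i(p)\le x_j(p)$ in $Q_p$, then $x_i(\tilde p)\le x_j(\tilde p)$ in $Q_{\tilde p}$.
   Context: $[k]=\{1,\dots,k\}$. For distinct reals $y_1,\dots,y_k$, $\mathrm{Order}(y_1,\dots,y_k)$ is the unique $\sigma\in S_k$ with $y_i<y_j$ iff $\sigma(i)<\sigma(j)$. $\rho,\rho':S_{k+1}\to S_k$: $\rho(\sigma)=\mathrm{Order}(\sigma(1),\dots,\sigma(k))$, $\rho'(\sigma)=\mathrm{Order}(\sigma(2),\dots,\sigma(k+1))$. The permutation digraph $G_k$ has vertex set $S_k$ and edge set $S_{k+1}$, edge $e$ directed from $\rho(e)$ to $\rho'(e)$. A path of length $\ell$ is $(v_0,e_1,v_1,\dots,e_\ell,v_\ell)$ with $e_i$ directed from $v_{i-1}$ to $v_i$. For a path $p=(v_0,e_1,\dots,v_\ell)$ in $G_{k+1}$, $\pi_{k+1,k}(p)=(\rho(v_0),v_0,\rho'(v_0),v_1,\rho'(v_1),\dots,v_\ell,\rho'(v_\ell))$, a path of length $\ell+1$ in $G_k$; $\pi_{m,k}=\pi_{k+1,k}\circ\cdots\circ\pi_{m,m-1}$ and $\pi_{k,k}=\mathrm{id}$. For a path $p$ of length $\ell$ in $G_k$, $Q_p=\{x_1(p),\dots,x_{\ell+k}(p)\}$ with $\le$ the reflexive-transitive closure of: $x_{a+c}\le x_{a+d}$ when $0\le a\le\ell$,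 $c,d\in[k]$, $v_a(c)\le v_a(d)$; $x_{a-1+c}\le x_{a-1+d}$ when $1\le a\le\ell$, $c,d\in[k+1]$, $e_a(c)\le e_a(d)$. (Note $Q_p$ and $Q_{\tilde p}$ have the same number of elements.) -}

module Defs where

open import Data.Nat using (ℕ; zero; suc; _+_; _<_; _≤_; _<?_)
open import Data.Fin using (Fin; toℕ; inject₁) renaming (suc to fsuc)
open import Data.Vec using (Vec; _∷_; []; lookup; tabulate; init; tail; head; map)
open import Data.List using (length; filter)
open import Data.List using () renaming (List to L)
open import Data.Fin.Base using ()
open import Data.List.Base using ()
open import Data.Product using (Σ; _×_; _,_; ∃)
open import Relation.Binary.PropositionalEquality using (_≡_)
open import Relation.Binary.Construct.Closure.ReflexiveTransitive using (Star)

-- Conventions: all positions and permutation values are 0-indexed.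
-- A permutation of [k] is a vector of k naturals (values 0..k-1, distinct).

allFinL : (k : ℕ) → L (Fin k)
allFinL zero = L.[]
allFinL (suc k) = Fin.zero L.∷ Data.List.map fsuc (allFinL k)
  where import Data.Fin as Fin

-- Order(y_1,…,y_k): the i-th entry is the rank of y_i, i.e. the number of
-- j with y_j < y_i (0-indexed value).  For distinct y this is the unique σ
-- with y_i < y_j iff σ(i) < σ(j).
Order : {k : ℕ} → Vec ℕ k → Vec ℕ k
Order {k} ys = tabulate λ i → length (filter (λ j → lookup ys j <? lookup ys i) (allFinL k))

IsPerm : (k : ℕ) → Vec ℕ k → Set
IsPerm k σ = (∀ i → lookup σ i < k) × (∀ i j → lookup σ i ≡ lookup σ j → i ≡ j)

ρ : {k : ℕ} → Vec ℕ (suc k) → Vec ℕ k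
ρ σ = Order (init σ)

ρ′ : {k : ℕ} → Vec ℕ (suc k) → Vec ℕ k
ρ′ σ = Order (tail σ)

-- Raw data of a path of length ℓ in G_k: vertices v_0,…,v_ℓ and edges e_1,…,e_ℓ
-- (edge e_{a+1} stored at index a).
RawPath : ℕ → ℕ → Set
RawPath k ℓ = Vec (Vec ℕ k) (suc ℓ) × Vec (Vec ℕ (suc k)) ℓ

vert : ∀ {k ℓ} → RawPath k ℓ → Fin (suc ℓ) → Vec ℕ k
vert (vs , es) a = lookup vs a

edge : ∀ {k ℓ} → RawPath k ℓ → Fin ℓ → Vec ℕ (suc k)
edge (vs , es) a = lookup es a

IsPath : ∀ {k ℓ} → RawPath k ℓ → Set
IsPath {k} {ℓ} p =
  (∀ a → IsPerm k (vert p a)) ×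
  (∀ a → IsPerm (suc k) (edge p a)) ×
  (∀ (a : Fin ℓ) → ρ (edge p a) ≡ vert p (inject₁ a)) ×
  (∀ (a : Fin ℓ) → ρ′ (edge p a) ≡ vert p (fsuc a))

π₁ : ∀ {k ℓ} → RawPath (suc k) ℓ → RawPath k (suc ℓ)
π₁ (vs , es) = (ρ (head vs) ∷ map ρ′ vs) , vs

πLen : ℕ → ℕ → ℕ
πLen zero ℓ = ℓ
πLen (suc d) ℓ = πLen d (suc ℓ)

π : ∀ (d : ℕ) {n ℓ} → RawPath (d + n) ℓ → RawPath n (πLen d ℓ)
π zero p = p
π (suc d) p = π d (π₁ p)

-- Generating relations of Q_p on element indices (x_1,…,x_{ℓ+k} ↦ 0,…,ℓ+k-1).
data Gen {k ℓ : ℕ} (p : RawPath k ℓ) : ℕ → ℕ → Set where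
  vgen : (a : Fin (suc ℓ)) (c d : Fin k) →
         lookup (vert p a) c ≤ lookup (vert p a) d →
         Gen p (toℕ a + toℕ c) (toℕ a + toℕ d)
  egen : (a : Fin ℓ) (c d : Fin (suc k)) →
         lookup (edge p a) c ≤ lookup (edge p a) d →
         Gen p (toℕ a + toℕ c) (toℕ a + toℕ d)

_≤Q[_]_ : ∀ {k ℓ} → ℕ → RawPath k ℓ → ℕ → Set
i ≤Q[ p ] j = Star (Gen p) i j

-- Every generating relation of Q_{π₁ q} is already a generating relation of Q_q, with
-- the same element indices, because Order reflects ≤: if y_d < y_c then fewer entries lie
-- below y_d than below y_c. An edge of π₁ q is a vertex of q, and the vertices of π₁ q are
-- ρ of the first vertex of q and ρ′ of each vertex of q, whose entries sit one position
-- further right. Iterating over the d projections of π d gives the theorem.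
module Submission where

open import Defs
open import Data.Nat using (ℕ; _+_; zero; suc; _<_; _≤_; _<?_)
open import Data.Nat.Properties using (≤∧≢⇒<; <-trans; <-irrefl; <⇒≱; ≰⇒>; _≤?_; +-suc)
open import Data.Fin using (Fin; toℕ; inject₁) renaming (zero to fzero; suc to fsuc)
open import Data.Fin.Properties using (toℕ-inject₁)
open import Data.Vec using (Vec; _∷_; lookup; init; tail)
open import Data.Vec.Properties using (lookup∘tabulate; lookup-map)
import Data.Vec as Vec
open import Data.List using (length; filter)
open import Data.List.Membership.Propositional using (_∈_)
open import Data.List.Membership.Propositional.Properties using (∈-map⁺; ∈-filter⁺; ∈-filter⁻)
open import Data.List.Relation.Unary.Any using (here; there)
open import Data.List.Relation.Binary.Pointwise using (Pointwise-≡⇒≡)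
open import Data.List.Relation.Binary.Sublist.Propositional using (⊆-refl)
  renaming (_⊆_ to _⊑_)
open import Data.List.Relation.Binary.Sublist.Propositional.Properties
  using (filter⁺; length-mono-≤; to-≋)
open import Data.Product using (_,_; proj₂)
open import Data.Empty using (⊥-elim)
open import Relation.Nullary using (yes; no; ¬_)
open import Relation.Unary using (Pred; Decidable; _⊆_)
open import Relation.Binary.PropositionalEquality using (_≡_; refl; sym; cong; subst; subst₂)
open import Relation.Binary.Construct.Closure.ReflexiveTransitive as Star using (Star)
open import Level using (0ℓ)

module _ {A : Set} {P Q : Pred A 0ℓ} (P? : Decidable P) (Q? : Decidable Q) (P⊆Q : P ⊆ Q) where

  filter-⊑ : ∀ xs → filter P? xs ⊑ filter Q? xs
  filter-⊑ xs = filter⁺ P? Q? (λ { refl → P⊆Q }) (⊆-refl {x = xs})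

  length-filter-mono : ∀ xs → length (filter P? xs) ≤ length (filter Q? xs)
  length-filter-mono xs = length-mono-≤ (filter-⊑ xs)

  -- Equal lengths would force the two filtered lists to coincide, putting x in the smaller one.
  length-filter-mono-< : ∀ {x xs} → x ∈ xs → Q x → ¬ P x →
                         length (filter P? xs) < length (filter Q? xs)
  length-filter-mono-< {x} {xs} x∈xs Qx ¬Px = ≤∧≢⇒< (length-filter-mono xs) λ same-length →
    let filters-equal = Pointwise-≡⇒≡ (to-≋ same-length (filter-⊑ xs))
        x∈filterP = subst (x ∈_) (sym filters-equal) (∈-filter⁺ Q? x∈xs Qx)
    in ¬Px (proj₂ (∈-filter⁻ P? {xs = xs} x∈filterP))

∈-allFinL : ∀ k (i : Fin k) → i ∈ allFinL k
∈-allFinL (suc k) fzero    = here refl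
∈-allFinL (suc k) (fsuc i) = there (∈-map⁺ fsuc (∈-allFinL k i))

rank : ∀ {k} → Vec ℕ k → Fin k → ℕ
rank {k} ys i = length (filter (λ j → lookup ys j <? lookup ys i) (allFinL k))

lookup-Order : ∀ {k} (ys : Vec ℕ k) i → lookup (Order ys) i ≡ rank ys i
lookup-Order ys i = lookup∘tabulate _ i

rank-mono-< : ∀ {k} (ys : Vec ℕ k) {c d} → lookup ys d < lookup ys c → rank ys d < rank ys c
rank-mono-< {k} ys {c} {d} yd<yc =
  length-filter-mono-< (λ j → lookup ys j <? lookup ys d) (λ j → lookup ys j <? lookup ys c)
    (λ yj<yd → <-trans yj<yd yd<yc) (∈-allFinL k d) yd<yc (<-irrefl refl)

Order-reflects-≤ : ∀ {k} (ys : Vec ℕ k) c d →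
                   lookup (Order ys) c ≤ lookup (Order ys) d → lookup ys c ≤ lookup ys d
Order-reflects-≤ ys c d Oc≤Od with lookup ys c ≤? lookup ys d
... | yes yc≤yd = yc≤yd
... | no  yc≰yd = ⊥-elim (<⇒≱ (rank-mono-< ys (≰⇒> yc≰yd))
                               (subst₂ _≤_ (lookup-Order ys c) (lookup-Order ys d) Oc≤Od))

lookup-init : ∀ {A : Set} {n} (v : Vec A (suc n)) c → lookup (init v) c ≡ lookup v (inject₁ c)
lookup-init (x ∷ y ∷ v) fzero    = refl
lookup-init (x ∷ y ∷ v) (fsuc c) = lookup-init (y ∷ v) c

lookup-tail : ∀ {A : Set} {n} (v : Vec A (suc n)) c → lookup (tail v) c ≡ lookup v (fsuc c)
lookup-tail (x ∷ v) c = refl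

ρ-reflects-≤ : ∀ {k} (v : Vec ℕ (suc k)) c d →
               lookup (ρ v) c ≤ lookup (ρ v) d → lookup v (inject₁ c) ≤ lookup v (inject₁ d)
ρ-reflects-≤ v c d ρc≤ρd =
  subst₂ _≤_ (lookup-init v c) (lookup-init v d) (Order-reflects-≤ (init v) c d ρc≤ρd)

ρ′-reflects-≤ : ∀ {k} (v : Vec ℕ (suc k)) c d →
                lookup (ρ′ v) c ≤ lookup (ρ′ v) d → lookup v (fsuc c) ≤ lookup v (fsuc d)
ρ′-reflects-≤ v c d ρ′c≤ρ′d =
  subst₂ _≤_ (lookup-tail v c) (lookup-tail v d) (Order-reflects-≤ (tail v) c d ρ′c≤ρ′d)

π₁-Gen⇒Gen : ∀ {k ℓ} (q : RawPath (suc k) ℓ) {i j} → Gen (π₁ q) i j → Gen q i j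
π₁-Gen⇒Gen _ (egen a c d ec≤ed) = vgen a c d ec≤ed
π₁-Gen⇒Gen q@(v ∷ _ , _) (vgen fzero c d vc≤vd) =
  subst₂ (Gen q) (toℕ-inject₁ c) (toℕ-inject₁ d)
    (vgen fzero (inject₁ c) (inject₁ d) (ρ-reflects-≤ v c d vc≤vd))
π₁-Gen⇒Gen q@(vs , _) (vgen (fsuc a) c d vc≤vd) =
  subst₂ (Gen q) (+-suc (toℕ a) (toℕ c)) (+-suc (toℕ a) (toℕ d))
    (vgen a (fsuc c) (fsuc d)
      (ρ′-reflects-≤ (lookup vs a) c d (subst₂ _≤_ (lookup-map-ρ′ c) (lookup-map-ρ′ d) vc≤vd)))
  where
  lookup-map-ρ′ : ∀ c → lookup (lookup (Vec.map ρ′ vs) a) c ≡ lookup (ρ′ (lookup vs a)) c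
  lookup-map-ρ′ c = cong (λ w → lookup w c) (lookup-map a ρ′ vs)

π-reflects-≤Q : ∀ d {n ℓ} (q : RawPath (d + n) ℓ) {i j} → i ≤Q[ π d q ] j → i ≤Q[ q ] j
π-reflects-≤Q zero    q i≤j = i≤j
π-reflects-≤Q (suc d) q i≤j = Star.map (π₁-Gen⇒Gen q) (π-reflects-≤Q d (π₁ q) i≤j)

lemma3p2 : (n d ℓ : ℕ) (p : RawPath n (πLen d ℓ)) (p̃ : RawPath (d + n) ℓ) →
           IsPath p → IsPath p̃ → π d p̃ ≡ p →
           (i j : ℕ) → i ≤Q[ p ] j → i ≤Q[ p̃ ] j
lemma3p2 n d ℓ p p̃ _ _ refl i j = π-reflects-≤Q d p̃
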